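{- If $w_1^0$ and $w_2^0$ are two highest weight vertices of $G_n$ with the same weight (i.e. $d(w_1^0)=d(w_2^0)$), then $w_1^0\equiv w_2^0$.
   Context: Alphabet $\mathcal{C}_n=\{1<\dots<n<\bar n<\dots<\bar 1\}$, words $\mathcal{C}_n^*$, crystal graph $G_n$ on $\mathcal{C}_n^*$ with arrows $w\xrightarrow{i}\tilde f_i(w)$, $\tilde e_i,\tilde f_i$ ($1\le i\le n$) Kashiwara's operators: on letters $\tilde f_i(i)=i+1$, $\tilde f_i(\overline{i+1})=\bar i$ for $i<n$, $\tilde f_n(n)=\bar n$, $\tilde e_i$ inverse, other values $0$; on words via the signature rule (mark letters with $\tilde f_i\ne0$ by $+$, with $\tilde e_i\ne0$ by $-$, cancel adjacent $+-$ pairs repeatedly, $\tilde f_i$ acts on leftmost remaining $+$, $\tilde e_i$ on rightmost remaining $-$, result $0$ if none). Highest weight vertex: $\tilde e_i(w)=0$ for all $i$. $d(w)_i$ = number of letters $i$ minus number of letters $\bar i$ in $w$. For a word and unbarred $m$, $N(m)$ = number of letters $x$ with $x\le m$ or $x\ge\bar m$; a strictly increasing word is an admissible column word if $N(m)\le m$ for all $m\le n$. $\equiv$ is the smallest monoid congruence on $\mathcal{C}_n^*$ containing: (R1) $yzx\equiv yxz$ for $x\le y<z$, $z\ne\bar x$, and $xzy\equiv zxy$ for $x<y\le z$, $z\ne\bar x$; (R2) $y(\overline{x-1})(x-1)\equiv yx\bar x$ and $x\bar xy\equiv(\overline{x-1})(x-1)y$ for $1<x\le n$, $x\le y\le\bar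 x$; (R3) $w\equiv\tilde w$ for every non-admissible strictly increasing word $w$ all of whose proper factors are admissible column words, $\tilde w$ obtained by erasing $z,\bar z$, $z$ the smallest unbarred letter with $z,\bar z\in w$ and $N(z)=z+1$. -}

module Defs where

open import Data.Nat using (ℕ; zero; suc; _≤_; _<_; _∸_; _≡ᵇ_; _<ᵇ_)
open import Data.Bool using (Bool; true; false; T; if_then_else_; _∧_; _∨_; not)
open import Data.Integer as ℤ using (ℤ; +_)
open import Data.List using (List; []; _∷_; _++_; length; map)
open import Data.List.Relation.Unary.All using (All)
open import Data.List.Relation.Unary.Linked using (Linked)
open import Data.List.Membership.Propositional using (_∈_)
open import Data.Maybe using (Maybe; just; nothing)
open import Data.Product using (_×_; ∃₂)
open import Data.Sum using (_⊎_)
open import Relation.Binary.PropositionalEquality using (_≡_; _≢_)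
open import Relation.Nullary using (¬_)

-- The alphabet C_n = {1 < … < n < n̄ < … < 1̄}.  Words of C_n^* are lists of
-- letters all of which are Valid n.

data Letter : Set where
  ub : ℕ → Letter
  br : ℕ → Letter

idx : Letter → ℕ
idx (ub m) = m
idx (br m) = m

Valid : ℕ → Letter → Set
Valid n x = 1 ≤ idx x × idx x ≤ n

Word : Set
Word = List Letter

bar : Letter → Letter
bar (ub m) = br m
bar (br m) = ub m

eqB : Letter → Letter → Bool
eqB (ub a) (ub b) = a ≡ᵇ b
eqB (br a) (br b) = a ≡ᵇ b
eqB _ _ = false

ltB : Letter → Letter → Bool
ltB (ub a) (ub b) = a <ᵇ b
ltB (ub a) (br b) = true
ltB (br a) (ub b) = false
ltB (br a) (br b) = b <ᵇ a

_<L_ : Letter → Letter → Set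
x <L y = T (ltB x y)

_≤L_ : Letter → Letter → Set
x ≤L y = x ≡ y ⊎ x <L y

data Sign : Set where
  plus minus none : Sign

-- plus: f̃_i(x) ≠ 0 ;  minus: ẽ_i(x) ≠ 0
sign : ℕ → ℕ → Letter → Sign
sign n i (ub m) = if m ≡ᵇ i then plus
                  else (if (i <ᵇ n) ∧ (m ≡ᵇ suc i) then minus else none)
sign n i (br m) = if m ≡ᵇ i then minus
                  else (if (i <ᵇ n) ∧ (m ≡ᵇ suc i) then plus else none)

eLetter : ℕ → ℕ → Letter → Maybe Letter
eLetter n i (ub m) = if (i <ᵇ n) ∧ (m ≡ᵇ suc i) then just (ub i) else nothing
eLetter n i (br m) = if m ≡ᵇ i
                     then (if i <ᵇ n then just (br (suc i)) else just (ub i))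
                     else nothing

-- Scan left to right; each minus cancels the nearest uncancelled plus on
-- its left (= repeatedly cancelling adjacent +- pairs).  Returns the
-- position of the rightmost uncancelled minus, if any.
-- arguments: open plus count, current position, accumulator.
lastFreeMinus : List Sign → ℕ → ℕ → Maybe ℕ → Maybe ℕ
lastFreeMinus [] k p acc = acc
lastFreeMinus (plus ∷ s) k p acc = lastFreeMinus s (suc k) (suc p) acc
lastFreeMinus (minus ∷ s) zero p acc = lastFreeMinus s zero (suc p) (just p)
lastFreeMinus (minus ∷ s) (suc k) p acc = lastFreeMinus s k (suc p) acc
lastFreeMinus (none ∷ s) k p acc = lastFreeMinus s k (suc p) acc

applyAt : ℕ → (Letter → Maybe Letter) → Word → Maybe Word
applyAt p g [] = nothing
applyAt zero g (x ∷ w) with g x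
... | just y = just (y ∷ w)
... | nothing = nothing
applyAt (suc p) g (x ∷ w) with applyAt p g w
... | just w' = just (x ∷ w')
... | nothing = nothing

-- ẽ_i(w); nothing represents 0
eTilde : ℕ → ℕ → Word → Maybe Word
eTilde n i w with lastFreeMinus (map (sign n i) w) 0 0 nothing
... | nothing = nothing
... | just p = applyAt p (eLetter n i) w

HighestWeight : ℕ → Word → Set
HighestWeight n w = ∀ i → 1 ≤ i → i ≤ n → eTilde n i w ≡ nothing

count : (Letter → Bool) → Word → ℕ
count p [] = 0
count p (x ∷ w) = if p x then suc (count p w) else count p w

d : Word → ℕ → ℤ
d w i = (+ count (eqB (ub i)) w) ℤ.- (+ count (eqB (br i)) w)

leB : Letter → Letter → Bool
leB x y = ltB x y ∨ eqB x y

N : ℕ → Word → ℕ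
N m w = count (λ x → leB x (ub m) ∨ leB (br m) x) w

StrictlyIncreasing : Word → Set
StrictlyIncreasing = Linked _<L_

AdmissibleColumn : ℕ → Word → Set
AdmissibleColumn n w = StrictlyIncreasing w × (∀ m → 1 ≤ m → m ≤ n → N m w ≤ m)

Factor : Word → Word → Set
Factor f w = ∃₂ λ u v → u ++ f ++ v ≡ w

eraseZ : ℕ → Word → Word
eraseZ z [] = []
eraseZ z (x ∷ w) = if eqB x (ub z) ∨ eqB x (br z) then eraseZ z w else x ∷ eraseZ z w

data Rule (n : ℕ) : Word → Word → Set where
  r1a : ∀ {x y z} → Valid n x → Valid n y → Valid n z →
        x ≤L y → y <L z → z ≢ bar x →
        Rule n (y ∷ z ∷ x ∷ []) (y ∷ x ∷ z ∷ [])
  r1b : ∀ {x y z} → Valid n x → Valid n y → Valid n z →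
        x <L y → y ≤L z → z ≢ bar x →
        Rule n (x ∷ z ∷ y ∷ []) (z ∷ x ∷ y ∷ [])
  r2a : ∀ {x y} → 1 < x → x ≤ n → Valid n y →
        ub x ≤L y → y ≤L br x →
        Rule n (y ∷ br (x ∸ 1) ∷ ub (x ∸ 1) ∷ []) (y ∷ ub x ∷ br x ∷ [])
  r2b : ∀ {x y} → 1 < x → x ≤ n → Valid n y →
        ub x ≤L y → y ≤L br x →
        Rule n (ub x ∷ br x ∷ y ∷ []) (br (x ∸ 1) ∷ ub (x ∸ 1) ∷ y ∷ [])
  r3  : ∀ {w z} → All (Valid n) w → StrictlyIncreasing w →
        ¬ AdmissibleColumn n w →
        (∀ f → Factor f w → length f < length w → AdmissibleColumn n f) →
        1 ≤ z → z ≤ n → ub z ∈ w → br z ∈ w → N z w ≡ suc z →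
        (∀ z' → 1 ≤ z' → z' < z →
           ¬ (ub z' ∈ w × br z' ∈ w × N z' w ≡ suc z')) →
        Rule n w (eraseZ z w)

-- the smallest congruence on C_n^* containing the rules:
-- equivalence closure of the two-sided context closure.
data _≡[_]_ : Word → ℕ → Word → Set where
  step   : ∀ {n u v l r} → All (Valid n) u → All (Valid n) v →
           Rule n l r → (u ++ l ++ v) ≡[ n ] (u ++ r ++ v)
  refl≡  : ∀ {n w} → w ≡[ n ] w
  sym≡   : ∀ {n w w'} → w ≡[ n ] w' → w' ≡[ n ] w
  trans≡ : ∀ {n w w' w''} → w ≡[ n ] w' → w' ≡[ n ] w'' → w ≡[ n ] w''

-- Scan a highest weight word w from the left.  Since no ẽ_i applies, the i-signature of
-- every prefix has no uncancelled −, and each letter x cancels an open + at i = source x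
-- and opens one at i = target x.  Inductively every prefix is therefore congruent to a
-- product of columns 1⋯m, with as many columns of height i as its i-signature has open +'s:
-- reading ī uses (R3), and columns commute by (R1).  The number of open +'s equals
-- d_i − d_{i+1} (with d_{n+1} = 0), so two highest weight words of the same weight have the
-- same normal form.

module Submission where

open import Defs
open import Data.Bool using (true; false; if_then_else_; _∧_; _∨_)
open import Data.Bool.Properties using (∧-zeroʳ)
open import Data.Empty using (⊥; ⊥-elim)
open import Data.Integer as ℤ using (ℤ; +_; 0ℤ; 1ℤ; -1ℤ)
open import Data.Integer.Properties using (pos-+; +-injective)
import Data.Integer.Properties as ℤ
open import Data.Integer.Tactic.RingSolver using (solve-∀)
open import Data.List using (List; []; _∷_; _++_; _∷ʳ_; [_]; length; map; concat; replicate)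
open import Data.List.Properties using (++-assoc; ++-identityʳ; map-++; length-++)
open import Data.List.Reverse using (Reverse; []; _∶_∶ʳ_; reverseView)
open import Data.List.Relation.Unary.All using (All; []; _∷_)
open import Data.List.Relation.Unary.All.Properties using (++⁺; ∷ʳ⁻; concat⁺; replicate⁺)
open import Data.List.Relation.Unary.Any using (here; there)
open import Data.List.Relation.Unary.Linked as Linked using (Linked; []; [-]; _∷_)
open import Data.List.Membership.Propositional using (_∈_)
open import Data.List.Membership.Propositional.Properties using (∈-++⁺ˡ; ∈-++⁺ʳ; ∈-++⁻)
open import Data.Maybe using (Maybe; just; nothing)
open import Data.Nat using (ℕ; zero; suc; pred; _+_; _≤_; _<_; _≡ᵇ_; _<ᵇ_; z≤n; s≤s; ≢-nonZero)
open import Data.Nat.Properties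
open import Data.Product using (∃-syntax; _×_; _,_; proj₁; proj₂)
open import Data.Sum using (_⊎_; inj₁; inj₂)
open import Data.Unit using (tt)
open import Function using (_∘_)
open import Level using (0ℓ)
open import Relation.Binary.Bundles using (Setoid)
open import Relation.Binary.PropositionalEquality hiding ([_])
open import Relation.Nullary using (¬_; yes; no)
open import Relation.Nullary.Decidable using (dec-true; dec-false)
import Relation.Binary.Reasoning.Setoid as SetoidReasoning

≡ᵇ-true : ∀ {m n} → m ≡ n → (m ≡ᵇ n) ≡ true
≡ᵇ-true {m} {n} = dec-true (m ≟ n)

≡ᵇ-false : ∀ {m n} → m ≢ n → (m ≡ᵇ n) ≡ false
≡ᵇ-false {m} {n} = dec-false (m ≟ n)

<ᵇ-true : ∀ {m n} → m < n → (m <ᵇ n) ≡ true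
<ᵇ-true {m} {n} = dec-true (m <? n)

<ᵇ-false : ∀ {m n} → ¬ m < n → (m <ᵇ n) ≡ false
<ᵇ-false {m} {n} = dec-false (m <? n)

≡[]-setoid : ℕ → Setoid 0ℓ 0ℓ
≡[]-setoid n = record
  { Carrier = Word
  ; _≈_ = _≡[ n ]_
  ; isEquivalence = record { refl = refl≡ ; sym = sym≡ ; trans = trans≡ }
  }

module ≡[]-Reasoning (n : ℕ) = SetoidReasoning (≡[]-setoid n)

≡⇒≡[] : ∀ {n a b} → a ≡ b → a ≡[ n ] b
≡⇒≡[] refl = refl≡

rule⇒≡[] : ∀ {n l r} → Rule n l r → l ≡[ n ] r
rule⇒≡[] {n} {l} {r} rule = subst₂ _≡[ n ]_ (++-identityʳ l) (++-identityʳ r) (step [] [] rule)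

++-cong : ∀ {n u v a b} → All (Valid n) u → All (Valid n) v →
          a ≡[ n ] b → (u ++ a ++ v) ≡[ n ] (u ++ b ++ v)
++-cong {n} {u} {v} vu vv (step {u = u′} {v = v′} {l = l} {r = r} vu′ vv′ rule) =
  subst₂ _≡[ n ]_ (reassoc l) (reassoc r) (step (++⁺ vu vu′) (++⁺ vv′ vv) rule)
  where
  reassoc : ∀ m → (u ++ u′) ++ m ++ v′ ++ v ≡ u ++ (u′ ++ m ++ v′) ++ v
  reassoc m = trans (++-assoc u u′ _)
    (cong (u ++_) (sym (trans (++-assoc u′ (m ++ v′) v) (cong (u′ ++_) (++-assoc m v′ v)))))
++-cong vu vv refl≡ = refl≡
++-cong vu vv (sym≡ p) = sym≡ (++-cong vu vv p)
++-cong vu vv (trans≡ p q) = trans≡ (++-cong vu vv p) (++-cong vu vv q)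

++-congˡ : ∀ {n u a b} → All (Valid n) u → a ≡[ n ] b → (u ++ a) ≡[ n ] (u ++ b)
++-congˡ {n} {u} {a} {b} vu p =
  subst₂ _≡[ n ]_ (cong (u ++_) (++-identityʳ a)) (cong (u ++_) (++-identityʳ b)) (++-cong vu [] p)

++-congʳ : ∀ {n v a b} → All (Valid n) v → a ≡[ n ] b → (a ++ v) ≡[ n ] (b ++ v)
++-congʳ vv = ++-cong [] vv

unmatched : List Sign → ℕ → ℕ
unmatched [] k = k
unmatched (plus ∷ s) k = unmatched s (suc k)
unmatched (minus ∷ s) zero = unmatched s zero
unmatched (minus ∷ s) (suc k) = unmatched s k
unmatched (none ∷ s) k = unmatched s k

unmatched-++ : ∀ s t k → unmatched (s ++ t) k ≡ unmatched t (unmatched s k)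
unmatched-++ [] t k = refl
unmatched-++ (plus ∷ s) t k = unmatched-++ s t (suc k)
unmatched-++ (minus ∷ s) t zero = unmatched-++ s t zero
unmatched-++ (minus ∷ s) t (suc k) = unmatched-++ s t k
unmatched-++ (none ∷ s) t k = unmatched-++ s t k

unmatched-minus : ∀ k → unmatched [ minus ] k ≡ pred k
unmatched-minus zero = refl
unmatched-minus (suc k) = refl

lastFreeMinus-++ : ∀ s t k p acc → lastFreeMinus (s ++ t) k p acc ≡
                   lastFreeMinus t (unmatched s k) (p + length s) (lastFreeMinus s k p acc)
lastFreeMinus-++ [] t k p acc = cong (λ q → lastFreeMinus t k q acc) (sym (+-identityʳ p))
lastFreeMinus-++ (plus ∷ s) t k p acc rewrite +-suc p (length s) = lastFreeMinus-++ s t (suc k) (suc p) acc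
lastFreeMinus-++ (minus ∷ s) t zero p acc rewrite +-suc p (length s) = lastFreeMinus-++ s t zero (suc p) (just p)
lastFreeMinus-++ (minus ∷ s) t (suc k) p acc rewrite +-suc p (length s) = lastFreeMinus-++ s t k (suc p) acc
lastFreeMinus-++ (none ∷ s) t k p acc rewrite +-suc p (length s) = lastFreeMinus-++ s t k (suc p) acc

lastFreeMinus≡nothing⇒acc≡nothing : ∀ s k p acc → lastFreeMinus s k p acc ≡ nothing → acc ≡ nothing
lastFreeMinus≡nothing⇒acc≡nothing [] k p acc e = e
lastFreeMinus≡nothing⇒acc≡nothing (plus ∷ s) k p acc e = lastFreeMinus≡nothing⇒acc≡nothing s (suc k) (suc p) acc e
lastFreeMinus≡nothing⇒acc≡nothing (minus ∷ s) zero p acc e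
  with () ← lastFreeMinus≡nothing⇒acc≡nothing s zero (suc p) (just p) e
lastFreeMinus≡nothing⇒acc≡nothing (minus ∷ s) (suc k) p acc e = lastFreeMinus≡nothing⇒acc≡nothing s k (suc p) acc e
lastFreeMinus≡nothing⇒acc≡nothing (none ∷ s) k p acc e = lastFreeMinus≡nothing⇒acc≡nothing s k (suc p) acc e

NoFreeMinus : ℕ → Word → Set
NoFreeMinus n w = ∀ i → 1 ≤ i → i ≤ n → lastFreeMinus (map (sign n i) w) 0 0 nothing ≡ nothing

charge : ℕ → Word → ℕ → ℕ
charge n w i = unmatched (map (sign n i) w) 0

charge-∷ʳ : ∀ n i w x → charge n (w ∷ʳ x) i ≡ unmatched [ sign n i x ] (charge n w i)
charge-∷ʳ n i w x =
  trans (cong (λ s → unmatched s 0) (map-++ (sign n i) w [ x ])) (unmatched-++ (map (sign n i) w) _ 0)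

lastFreeMinus-∷ʳ : ∀ n i w x →
  lastFreeMinus (map (sign n i) (w ∷ʳ x)) 0 0 nothing ≡
  lastFreeMinus [ sign n i x ] (charge n w i) (length (map (sign n i) w)) (lastFreeMinus (map (sign n i) w) 0 0 nothing)
lastFreeMinus-∷ʳ n i w x =
  trans (cong (λ s → lastFreeMinus s 0 0 nothing) (map-++ (sign n i) w [ x ]))
        (lastFreeMinus-++ (map (sign n i) w) _ 0 0 nothing)

noFreeMinus-∷ʳ⁻ : ∀ {n w x} → NoFreeMinus n (w ∷ʳ x) → NoFreeMinus n w
noFreeMinus-∷ʳ⁻ {n} {w} {x} nf i 1≤i i≤n =
  lastFreeMinus≡nothing⇒acc≡nothing [ sign n i x ] _ _ _ (trans (sym (lastFreeMinus-∷ʳ n i w x)) (nf i 1≤i i≤n))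

charge-nonzero : ∀ {n w x i} → NoFreeMinus n (w ∷ʳ x) → 1 ≤ i → i ≤ n →
                 sign n i x ≡ minus → charge n w i ≢ 0
charge-nonzero {n} {w} {x} {i} nf 1≤i i≤n σ≡minus k≡0 =
  minus-free σ≡minus k≡0 (noFreeMinus-∷ʳ⁻ {w = w} {x} nf i 1≤i i≤n) (trans (sym (lastFreeMinus-∷ʳ n i w x)) (nf i 1≤i i≤n))
  where
  minus-free : ∀ {σ k p acc} → σ ≡ minus → k ≡ 0 → acc ≡ nothing → lastFreeMinus [ σ ] k p acc ≢ nothing
  minus-free refl refl refl ()

eLetter-minus : ∀ n i x → sign n i x ≡ minus → eLetter n i x ≢ nothing
eLetter-minus n i (ub m) σ≡minus with m ≡ᵇ i | (i <ᵇ n) ∧ (m ≡ᵇ suc i)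
eLetter-minus n i (ub m) () | true | _
eLetter-minus n i (ub m) _ | false | true = λ ()
eLetter-minus n i (ub m) () | false | false
eLetter-minus n i (br m) σ≡minus with m ≡ᵇ i | i <ᵇ n | (i <ᵇ n) ∧ (m ≡ᵇ suc i)
eLetter-minus n i (br m) _ | true | true | _ = λ ()
eLetter-minus n i (br m) _ | true | false | _ = λ ()
eLetter-minus n i (br m) () | false | _ | true
eLetter-minus n i (br m) () | false | _ | false

applyAt-here : ∀ g x w → g x ≢ nothing → applyAt 0 g (x ∷ w) ≢ nothing
applyAt-here g x w gx≢nothing with g x
... | just _ = λ ()
... | nothing = ⊥-elim (gx≢nothing refl)

applyAt-there : ∀ j g x w → applyAt j g w ≢ nothing → applyAt (suc j) g (x ∷ w) ≢ nothing
applyAt-there j g x w ok with applyAt j g w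
... | just _ = λ ()
... | nothing = ⊥-elim (ok refl)

ApplicableAt : ℕ → ℕ → Word → ℕ → Set
ApplicableAt n i w j = applyAt j (eLetter n i) w ≢ nothing

FreeMinusOrigin : ℕ → ℕ → Word → ℕ → Maybe ℕ → ℕ → Set
FreeMinusOrigin n i w p acc q = acc ≡ just q ⊎ ∃[ j ] (q ≡ p + j × ApplicableAt n i w j)

freeMinusOrigin-∷ : ∀ {n i x w p acc q} → FreeMinusOrigin n i w (suc p) acc q → FreeMinusOrigin n i (x ∷ w) p acc q
freeMinusOrigin-∷ (inj₁ e) = inj₁ e
freeMinusOrigin-∷ {n} {i} {x} {w} {p} (inj₂ (j , q≡ , ok)) =
  inj₂ (suc j , trans q≡ (sym (+-suc p j)) , applyAt-there j (eLetter n i) x w ok)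

lastFreeMinus-origin : ∀ {n i} w k p acc {q} → lastFreeMinus (map (sign n i) w) k p acc ≡ just q →
                       FreeMinusOrigin n i w p acc q
lastFreeMinus-origin [] k p acc e = inj₁ e
lastFreeMinus-origin {n} {i} (x ∷ w) k p acc e with sign n i x in σ | k
... | plus | k′ = freeMinusOrigin-∷ (lastFreeMinus-origin w (suc k′) (suc p) acc e)
... | none | k′ = freeMinusOrigin-∷ (lastFreeMinus-origin w k′ (suc p) acc e)
... | minus | suc k′ = freeMinusOrigin-∷ (lastFreeMinus-origin w k′ (suc p) acc e)
... | minus | zero with lastFreeMinus-origin w zero (suc p) (just p) e
...   | inj₁ refl = inj₂ (0 , sym (+-identityʳ p) , applyAt-here (eLetter n i) x w (eLetter-minus n i x σ))
...   | inj₂ found = freeMinusOrigin-∷ (inj₂ found)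

eTilde-at : ∀ n i w {p} → lastFreeMinus (map (sign n i) w) 0 0 nothing ≡ just p →
            eTilde n i w ≡ applyAt p (eLetter n i) w
eTilde-at n i w eq rewrite eq = refl

highestWeight⇒noFreeMinus : ∀ {n w} → HighestWeight n w → NoFreeMinus n w
highestWeight⇒noFreeMinus {n} {w} hw i 1≤i i≤n with lastFreeMinus (map (sign n i) w) 0 0 nothing in eq
... | nothing = refl
... | just p with lastFreeMinus-origin w 0 0 nothing eq
...   | inj₂ (j , refl , ok) = ⊥-elim (ok (trans (sym (eTilde-at n i w eq)) (hw i 1≤i i≤n)))

-- Appending x to the column of height source x yields the column of height target x
-- (1⋯(i−1)·i = 1⋯i, and 1⋯i·ī ≡ 1⋯(i−1) by (R3)); a column of height 0 is empty.
source target : Letter → ℕ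
source (ub m) = pred m
source (br m) = m
target (ub m) = m
target (br m) = pred m

source≢target : ∀ {n} x → Valid n x → source x ≢ target x
source≢target (ub (suc m)) _ = 1+n≢n ∘ sym
source≢target (br (suc m)) _ = 1+n≢n

source≤n : ∀ {n} x → Valid n x → source x ≤ n
source≤n (ub m) (_ , m≤n) = ≤-trans pred[n]≤n m≤n
source≤n (br m) (_ , m≤n) = m≤n

target≤n : ∀ {n} x → Valid n x → target x ≤ n
target≤n (ub m) (_ , m≤n) = m≤n
target≤n (br m) (_ , m≤n) = ≤-trans pred[n]≤n m≤n

sign-target : ∀ {n i} x → Valid n x → i ≡ target x → sign n i x ≡ plus
sign-target (ub m) _ refl rewrite ≡ᵇ-true {m} refl = refl
sign-target {i = i} (br (suc i)) (_ , i<n) refl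
  rewrite ≡ᵇ-false {suc i} {i} 1+n≢n | <ᵇ-true i<n | ≡ᵇ-true {i} refl = refl

sign-source : ∀ {n i} x → Valid n x → i ≡ source x → sign n i x ≡ minus
sign-source {i = i} (ub (suc i)) (_ , i<n) refl
  rewrite ≡ᵇ-false {suc i} {i} 1+n≢n | <ᵇ-true i<n | ≡ᵇ-true {i} refl = refl
sign-source (br m) _ refl rewrite ≡ᵇ-true {m} refl = refl

sign-other : ∀ {n i} x → i ≢ source x → i ≢ target x → sign n i x ≡ none
sign-other {n} {i} (ub m) i≢s i≢t
  rewrite ≡ᵇ-false (i≢t ∘ sym) | ≡ᵇ-false {m} {suc i} (i≢s ∘ sym ∘ cong pred) | ∧-zeroʳ (i <ᵇ n) = refl
sign-other {n} {i} (br m) i≢s i≢t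
  rewrite ≡ᵇ-false (i≢s ∘ sym) | ≡ᵇ-false {m} {suc i} (i≢t ∘ sym ∘ cong pred) | ∧-zeroʳ (i <ᵇ n) = refl

signValue : Sign → ℤ
signValue plus = 1ℤ
signValue minus = -1ℤ
signValue none = 0ℤ

unmatched-step : ∀ σ k → (σ ≡ minus → k ≢ 0) → + unmatched [ σ ] k ≡ + k ℤ.+ signValue σ
unmatched-step plus k _ = cong +_ (+-comm 1 k)
unmatched-step minus zero k≢0 = ⊥-elim (k≢0 refl refl)
unmatched-step minus (suc k) _ = refl
unmatched-step none k _ = sym (ℤ.+-identityʳ (+ k))

sub-+-interchange : ∀ (a b c e : ℤ) → (a ℤ.- b) ℤ.+ (c ℤ.- e) ≡ (a ℤ.+ c) ℤ.- (b ℤ.+ e)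
sub-+-interchange = solve-∀

count-++ : ∀ p u v → count p (u ++ v) ≡ count p u + count p v
count-++ p [] v = refl
count-++ p (x ∷ u) v with p x
... | true = cong suc (count-++ p u v)
... | false = count-++ p u v

d-++ : ∀ u v i → d (u ++ v) i ≡ d u i ℤ.+ d v i
d-++ u v i = begin
  + U (u ++ v) ℤ.- + B (u ++ v)             ≡⟨ cong₂ (λ a b → + a ℤ.- + b) (count-++ _ u v) (count-++ _ u v) ⟩
  + (U u + U v) ℤ.- + (B u + B v)           ≡⟨ cong₂ ℤ._-_ (pos-+ (U u) (U v)) (pos-+ (B u) (B v)) ⟩
  (+ U u ℤ.+ + U v) ℤ.- (+ B u ℤ.+ + B v)   ≡⟨ sub-+-interchange (+ U u) (+ B u) (+ U v) (+ B v) ⟨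
  d u i ℤ.+ d v i                           ∎
  where
  open ≡-Reasoning
  U B : Word → ℕ
  U = count (eqB (ub i))
  B = count (eqB (br i))

weight-letter : ∀ {n i} x → Valid n x → d [ x ] i ℤ.- d [ x ] (suc i) ≡ signValue (sign n i x)
weight-letter {n} {i} (ub (suc m)) vx with i ≟ suc m | i ≟ m
... | yes refl | _ rewrite sign-target (ub i) vx refl | ≡ᵇ-true {i} refl | ≡ᵇ-false {suc i} {i} 1+n≢n = refl
... | no _ | yes refl rewrite sign-source (ub (suc i)) vx refl | ≡ᵇ-false {i} {suc i} (1+n≢n ∘ sym) | ≡ᵇ-true {i} refl = refl
... | no i≢t | no i≢s rewrite sign-other {n} (ub (suc m)) i≢s i≢t | ≡ᵇ-false i≢t | ≡ᵇ-false (i≢s ∘ suc-injective) = refl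
weight-letter {n} {i} (br (suc m)) vx with i ≟ suc m | i ≟ m
... | yes refl | _ rewrite sign-source (br i) vx refl | ≡ᵇ-true {i} refl | ≡ᵇ-false {suc i} {i} 1+n≢n = refl
... | no _ | yes refl rewrite sign-target (br (suc i)) vx refl | ≡ᵇ-false {i} {suc i} (1+n≢n ∘ sym) | ≡ᵇ-true {i} refl = refl
... | no i≢s | no i≢t rewrite sign-other {n} (br (suc m)) i≢s i≢t | ≡ᵇ-false i≢s | ≡ᵇ-false (i≢t ∘ suc-injective) = refl

charge-weight : ∀ {n w i} → Reverse w → All (Valid n) w → NoFreeMinus n w → 1 ≤ i → i ≤ n →
                + charge n w i ≡ d w i ℤ.- d w (suc i)
charge-weight [] _ _ _ _ = refl
charge-weight {n} {i = i} (w ∶ r ∶ʳ x) v nf 1≤i i≤n = begin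
  + charge n (w ∷ʳ x) i                                      ≡⟨ cong +_ (charge-∷ʳ n i w x) ⟩
  + unmatched [ sign n i x ] (charge n w i)                  ≡⟨ unmatched-step _ _ (charge-nonzero {w = w} nf 1≤i i≤n) ⟩
  + charge n w i ℤ.+ signValue (sign n i x)                  ≡⟨ cong₂ ℤ._+_ (charge-weight r vw (noFreeMinus-∷ʳ⁻ {w = w} nf) 1≤i i≤n)
                                                                             (sym (weight-letter x vx)) ⟩
  (d w i ℤ.- d w (suc i)) ℤ.+ (d [ x ] i ℤ.- d [ x ] (suc i)) ≡⟨ sub-+-interchange (d w i) _ _ _ ⟩
  (d w i ℤ.+ d [ x ] i) ℤ.- (d w (suc i) ℤ.+ d [ x ] (suc i)) ≡⟨ cong₂ ℤ._-_ (d-++ w [ x ] i) (d-++ w [ x ] (suc i)) ⟨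
  d (w ∷ʳ x) i ℤ.- d (w ∷ʳ x) (suc i)                        ∎
  where
  open ≡-Reasoning
  vw = proj₁ (∷ʳ⁻ v)
  vx = proj₂ (∷ʳ⁻ v)

count-absent : ∀ {P : Letter → Set} {w} p → (∀ {x} → P x → p x ≡ false) → All P w → count p w ≡ 0
count-absent p absent [] = refl
count-absent p absent (px ∷ pw) rewrite absent px = count-absent p absent pw

weight-beyond : ∀ {n w} → All (Valid n) w → d w (suc n) ≡ 0ℤ
weight-beyond {n} {w} v =
  cong₂ (λ a b → + a ℤ.- + b) (count-absent _ (λ {x} → ub-absent {x}) v) (count-absent _ (λ {x} → br-absent {x}) v)
  where
  ub-absent : ∀ {x} → Valid n x → eqB (ub (suc n)) x ≡ false
  ub-absent {ub m} (_ , m≤n) = ≡ᵇ-false (λ e → 1+n≰n (subst (_≤ n) (sym e) m≤n))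
  ub-absent {br m} _ = refl
  br-absent : ∀ {x} → Valid n x → eqB (br (suc n)) x ≡ false
  br-absent {ub m} _ = refl
  br-absent {br m} (_ , m≤n) = ≡ᵇ-false (λ e → 1+n≰n (subst (_≤ n) (sym e) m≤n))

run : ℕ → ℕ → Word
run r zero = []
run r (suc k) = ub r ∷ run (suc r) k

column : ℕ → Word
column = run 1

length-run : ∀ r k → length (run r k) ≡ k
length-run r zero = refl
length-run r (suc k) = cong suc (length-run (suc r) k)

run-++ : ∀ r a b → run r (a + b) ≡ run r a ++ run (r + a) b
run-++ r zero b = cong (λ s → run s b) (sym (+-identityʳ r))
run-++ r (suc a) b = cong (ub r ∷_) (trans (run-++ (suc r) a b) (cong (λ s → run (suc r) a ++ run s b) (sym (+-suc r a))))

run-∷ʳ : ∀ r k → run r (suc k) ≡ run r k ∷ʳ ub (r + k)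
run-∷ʳ r k = trans (cong (run r) (+-comm 1 k)) (run-++ r k 1)

run-valid : ∀ {n} r k → 1 ≤ r → r + k ≤ suc n → All (Valid n) (run r k)
run-valid r zero _ _ = []
run-valid r (suc k) 1≤r r+k<n rewrite +-suc r k =
  (1≤r , ≤-trans (m≤m+n r k) (≤-pred r+k<n)) ∷ run-valid (suc r) k (s≤s z≤n) r+k<n

column-valid : ∀ {n m} → m ≤ n → All (Valid n) (column m)
column-valid {m = m} m≤n = run-valid 1 m (s≤s z≤n) (s≤s m≤n)

≤⇒≤L : ∀ {a b} → a ≤ b → ub a ≤L ub b
≤⇒≤L a≤b with m≤n⇒m<n∨m≡n a≤b
... | inj₁ a<b = inj₂ (<⇒<ᵇ a<b)
... | inj₂ refl = inj₁ refl

-- x moves left past each larger letter by (R1) y z x ≡ y x z, its left neighbour serving as y.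
run-insert : ∀ {n} x r l → 1 ≤ x → x ≤ r → r + l ≤ n →
             (run r (suc l) ∷ʳ ub x) ≡[ n ] (ub r ∷ ub x ∷ run (suc r) l)
run-insert x r zero _ _ _ = refl≡
run-insert {n} x r (suc l) 1≤x x≤r r+l≤n rewrite +-suc r l =
  trans≡ (++-congˡ (vr ∷ []) (run-insert x (suc r) l 1≤x (m≤n⇒m≤1+n x≤r) r+l≤n))
         (step [] (run-valid (suc (suc r)) l (s≤s z≤n) (s≤s r+l≤n))
               (r1a (1≤x , ≤-trans x≤r r≤n) vr (s≤s z≤n , r<n) (≤⇒≤L x≤r) (<⇒<ᵇ (n<1+n r)) (λ ())))
  where
  r<n : suc r ≤ n
  r<n = ≤-trans (s≤s (m≤m+n r l)) r+l≤n
  r≤n : r ≤ n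
  r≤n = ≤-trans (n≤1+n r) r<n
  vr : Valid n (ub r)
  vr = ≤-trans 1≤x x≤r , r≤n

doubled : ℕ → Word
doubled zero = []
doubled (suc a) = doubled a ++ ub (suc a) ∷ ub (suc a) ∷ []

column-merge : ∀ {n} a l → a + l ≤ n → (column (a + l) ++ column a) ≡[ n ] (doubled a ++ run (suc a) l)
column-merge zero l _ = ≡⇒≡[] (++-identityʳ (column l))
column-merge {n} (suc a) l sa+l≤n = begin
  column (suc a + l) ++ column (suc a)              ≡⟨ cong₂ _++_ (cong column (sym (+-suc a l))) (run-∷ʳ 1 a) ⟩
  column (a + suc l) ++ (column a ∷ʳ ub (suc a))    ≡⟨ ++-assoc (column (a + suc l)) (column a) _ ⟨
  (column (a + suc l) ++ column a) ∷ʳ ub (suc a)    ≈⟨ ++-congʳ (va ∷ []) (column-merge a (suc l) a+sl≤n) ⟩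
  (doubled a ++ run (suc a) (suc l)) ∷ʳ ub (suc a)  ≡⟨ ++-assoc (doubled a) _ _ ⟩
  doubled a ++ (run (suc a) (suc l) ∷ʳ ub (suc a))  ≈⟨ ++-congˡ (doubled-valid a (≤-trans (n≤1+n a) (proj₂ va)))
                                                                   (run-insert (suc a) (suc a) l (s≤s z≤n) ≤-refl sa+l≤n) ⟩
  doubled a ++ ub (suc a) ∷ ub (suc a) ∷ run (suc (suc a)) l  ≡⟨ ++-assoc (doubled a) _ _ ⟨
  doubled (suc a) ++ run (suc (suc a)) l            ∎
  where
  open ≡[]-Reasoning n
  a+sl≤n : a + suc l ≤ n
  a+sl≤n = subst (_≤ n) (sym (+-suc a l)) sa+l≤n
  va : Valid n (ub (suc a))
  va = s≤s z≤n , ≤-trans (m≤m+n (suc a) l) sa+l≤n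
  doubled-valid : ∀ b → b ≤ n → All (Valid n) (doubled b)
  doubled-valid zero _ = []
  doubled-valid (suc b) b≤n = ++⁺ (doubled-valid b (≤-trans (n≤1+n b) b≤n)) ((s≤s z≤n , b≤n) ∷ (s≤s z≤n , b≤n) ∷ [])

column-comm-+ : ∀ {n} a l → a + l ≤ n → (column a ++ column (a + l)) ≡[ n ] (column (a + l) ++ column a)
column-comm-+ {n} a l a+l≤n = begin
  column a ++ column (a + l)                 ≡⟨ cong (column a ++_) (run-++ 1 a l) ⟩
  column a ++ (column a ++ run (suc a) l)    ≡⟨ ++-assoc (column a) _ _ ⟨
  (column a ++ column a) ++ run (suc a) l    ≈⟨ ++-congʳ (run-valid (suc a) l (s≤s z≤n) (s≤s a+l≤n)) square ⟩
  doubled a ++ run (suc a) l                 ≈⟨ column-merge a l a+l≤n ⟨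
  column (a + l) ++ column a                 ∎
  where
  open ≡[]-Reasoning n
  square : (column a ++ column a) ≡[ n ] doubled a
  square = subst₂ (λ b c → (column b ++ column a) ≡[ n ] c) (+-identityʳ a) (++-identityʳ (doubled a))
             (column-merge a 0 (subst (_≤ n) (sym (+-identityʳ a)) (≤-trans (m≤m+n a l) a+l≤n)))

column-comm : ∀ {n a b} → a ≤ n → b ≤ n → (column a ++ column b) ≡[ n ] (column b ++ column a)
column-comm {n} {a} {b} a≤n b≤n with ≤-total a b
... | inj₁ a≤b with m≤n⇒∃[o]m+o≡n a≤b
...   | l , refl = column-comm-+ a l b≤n
column-comm {n} {a} {b} a≤n b≤n | inj₂ b≤a with m≤n⇒∃[o]m+o≡n b≤a
...   | l , refl = sym≡ (column-comm-+ b l a≤n)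

count≤length : ∀ p u → count p u ≤ length u
count≤length p [] = z≤n
count≤length p (x ∷ u) with p x
... | true = s≤s (count≤length p u)
... | false = m≤n⇒m≤1+n (count≤length p u)

count-infix : ∀ p u f v → count p f ≤ count p (u ++ f ++ v)
count-infix p u f v = begin
  count p f                      ≤⟨ m≤m+n _ _ ⟩
  count p f + count p v          ≡⟨ count-++ p f v ⟨
  count p (f ++ v)               ≤⟨ m≤n+m _ _ ⟩
  count p u + count p (f ++ v)   ≡⟨ count-++ p u (f ++ v) ⟨
  count p (u ++ f ++ v)          ∎
  where open ≤-Reasoning

N-run-below : ∀ m r len → r + len ≤ suc m → N m (run r len) ≡ len
N-run-below m r zero _ = refl
N-run-below m r (suc len) r+len≤m rewrite +-suc r len with m≤n⇒m<n∨m≡n (≤-trans (m≤m+n r len) (≤-pred r+len≤m))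
... | inj₁ r<m rewrite <ᵇ-true r<m = cong suc (N-run-below m (suc r) len r+len≤m)
... | inj₂ refl rewrite <ᵇ-false (n≮n r) | ≡ᵇ-true {r} refl = cong suc (N-run-below r (suc r) len r+len≤m)

N-run-above : ∀ m r len → m < r → N m (run r len) ≡ 0
N-run-above m r zero _ = refl
N-run-above m r (suc len) m<r rewrite <ᵇ-false (<⇒≯ m<r) | ≡ᵇ-false (<⇒≢ m<r ∘ sym) =
  N-run-above m (suc r) len (m≤n⇒m≤1+n m<r)

N-column : ∀ {m c} → m ≤ c → N m (column c) ≡ m
N-column {m} {c} m≤c with m≤n⇒∃[o]m+o≡n m≤c
... | l , refl = begin
  N m (column (m + l))                    ≡⟨ cong (N m) (run-++ 1 m l) ⟩
  N m (column m ++ run (suc m) l)         ≡⟨ count-++ _ (column m) _ ⟩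
  N m (column m) + N m (run (suc m) l)    ≡⟨ cong₂ _+_ (N-run-below m 1 m ≤-refl) (N-run-above m (suc m) l ≤-refl) ⟩
  m + 0                                   ≡⟨ +-identityʳ m ⟩
  m                                       ∎
  where open ≡-Reasoning

N-bar-above : ∀ {m c} → m < c → N m [ br c ] ≡ 0
N-bar-above {m} {c} m<c rewrite <ᵇ-false (<⇒≯ m<c) | ≡ᵇ-false (<⇒≢ m<c) = refl

N-bar-self : ∀ c → N c [ br c ] ≡ 1
N-bar-self c rewrite <ᵇ-false (n≮n c) | ≡ᵇ-true {c} refl = refl

Linked-infix : ∀ {A : Set} {R : A → A → Set} u {f v} → Linked R (u ++ f ++ v) → Linked R f
Linked-infix [] {[]} _ = []
Linked-infix [] {x ∷ []} _ = [-]
Linked-infix [] {x ∷ y ∷ f} (Rxy ∷ rest) = Rxy ∷ Linked-infix [] rest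
Linked-infix (x ∷ u) linked = Linked-infix u (Linked.tail linked)

run-bar-increasing : ∀ r k m → StrictlyIncreasing (run r k ∷ʳ br m)
run-bar-increasing r zero m = [-]
run-bar-increasing r (suc zero) m = tt ∷ [-]
run-bar-increasing r (suc (suc k)) m = <⇒<ᵇ (n<1+n r) ∷ run-bar-increasing (suc r) (suc k) m

br∉run : ∀ {z} r k → br z ∈ run r k → ⊥
br∉run r (suc k) (there p) = br∉run (suc r) k p

eraseZ-++ : ∀ z u v → eraseZ z (u ++ v) ≡ eraseZ z u ++ eraseZ z v
eraseZ-++ z [] v = refl
eraseZ-++ z (x ∷ u) v with eqB x (ub z) ∨ eqB x (br z)
... | true = eraseZ-++ z u v
... | false = cong (x ∷_) (eraseZ-++ z u v)

eraseZ-run : ∀ z r len → r + len ≤ z → eraseZ z (run r len) ≡ run r len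
eraseZ-run z r zero _ = refl
eraseZ-run z r (suc len) r+len<z rewrite +-suc r len | ≡ᵇ-false {r} {z} (<⇒≢ (≤-trans (s≤s (m≤m+n r len)) r+len<z)) =
  cong (ub r ∷_) (eraseZ-run z (suc r) len r+len<z)

column-bar-rule : ∀ {n} j → suc j ≤ n →
                  Rule n (column (suc j) ∷ʳ br (suc j)) (eraseZ (suc j) (column (suc j) ∷ʳ br (suc j)))
column-bar-rule {n} j sj≤n =
  r3 valid increasing non-admissible proper-admissible (s≤s z≤n) sj≤n ub∈W br∈W N-top minimal
  where
  W : Word
  W = column (suc j) ∷ʳ br (suc j)
  valid : All (Valid n) W
  valid = ++⁺ (column-valid sj≤n) ((s≤s z≤n , sj≤n) ∷ [])
  increasing : StrictlyIncreasing W
  increasing = run-bar-increasing 1 (suc j) (suc j)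
  N-below : ∀ {m} → m ≤ j → N m W ≡ m
  N-below {m} m≤j = trans (count-++ _ (column (suc j)) _)
    (trans (cong₂ _+_ (N-column (m≤n⇒m≤1+n m≤j)) (N-bar-above (s≤s m≤j))) (+-identityʳ m))
  N-top : N (suc j) W ≡ suc (suc j)
  N-top = trans (count-++ _ (column (suc j)) _)
    (trans (cong₂ _+_ (N-column ≤-refl) (N-bar-self (suc j))) (+-comm (suc j) 1))
  non-admissible : ¬ AdmissibleColumn n W
  non-admissible (_ , bounded) = 1+n≰n (subst (_≤ suc j) N-top (bounded (suc j) (s≤s z≤n) sj≤n))
  length-W : length W ≡ suc (suc j)
  length-W = trans (length-++ (column (suc j))) (trans (cong (_+ 1) (length-run 1 (suc j))) (+-comm (suc j) 1))
  proper-admissible : ∀ f → Factor f W → length f < length W → AdmissibleColumn n f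
  proper-admissible f (u , v , e) |f|<|W| = Linked-infix u (subst StrictlyIncreasing (sym e) increasing) , bounded
    where
    bounded : ∀ m → 1 ≤ m → m ≤ n → N m f ≤ m
    bounded m _ _ with m ≤? j
    ... | yes m≤j = ≤-trans (count-infix _ u f v) (≤-reflexive (trans (cong (N m) e) (N-below m≤j)))
    ... | no m≰j = ≤-trans (count≤length _ f) (≤-trans (≤-pred (subst (length f <_) length-W |f|<|W|)) (≰⇒> m≰j))
  ub∈W : ub (suc j) ∈ W
  ub∈W = ∈-++⁺ˡ (subst (ub (suc j) ∈_) (sym (run-∷ʳ 1 j)) (∈-++⁺ʳ (column j) (here refl)))
  br∈W : br (suc j) ∈ W
  br∈W = ∈-++⁺ʳ (column (suc j)) (here refl)
  minimal : ∀ z → 1 ≤ z → z < suc j → ¬ (ub z ∈ W × br z ∈ W × N z W ≡ suc z)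
  minimal z _ z<sj (_ , br∈ , _) with ∈-++⁻ (column (suc j)) br∈
  ... | inj₁ br∈column = br∉run 1 (suc j) br∈column
  ... | inj₂ (here refl) = n≮n (suc j) z<sj

eraseZ-column-bar : ∀ j → eraseZ (suc j) (column (suc j) ∷ʳ br (suc j)) ≡ column j
eraseZ-column-bar j = begin
  eraseZ (suc j) (column (suc j) ∷ʳ br (suc j))                   ≡⟨ cong (λ c → eraseZ (suc j) (c ∷ʳ br (suc j))) (run-∷ʳ 1 j) ⟩
  eraseZ (suc j) ((column j ∷ʳ ub (suc j)) ∷ʳ br (suc j))         ≡⟨ cong (eraseZ (suc j)) (++-assoc (column j) _ _) ⟩
  eraseZ (suc j) (column j ++ ub (suc j) ∷ br (suc j) ∷ [])       ≡⟨ eraseZ-++ (suc j) (column j) _ ⟩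
  eraseZ (suc j) (column j) ++ eraseZ (suc j) (ub (suc j) ∷ br (suc j) ∷ [])
                                                                  ≡⟨ cong₂ _++_ (eraseZ-run (suc j) 1 j ≤-refl) erase-pair ⟩
  column j ++ []                                                  ≡⟨ ++-identityʳ (column j) ⟩
  column j                                                        ∎
  where
  open ≡-Reasoning
  erase-pair : eraseZ (suc j) (ub (suc j) ∷ br (suc j) ∷ []) ≡ []
  erase-pair rewrite ≡ᵇ-true {j} refl = refl

column-bar : ∀ {n} j → suc j ≤ n → (column (suc j) ∷ʳ br (suc j)) ≡[ n ] column j
column-bar {n} j sj≤n = subst ((column (suc j) ∷ʳ br (suc j)) ≡[ n ]_) (eraseZ-column-bar j) (rule⇒≡[] (column-bar-rule j sj≤n))

column-letter : ∀ {n} x → Valid n x → (column (source x) ∷ʳ x) ≡[ n ] column (target x)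
column-letter (ub (suc m)) _ = ≡⇒≡[] (sym (run-∷ʳ 1 m))
column-letter (br (suc j)) (_ , sj≤n) = column-bar j sj≤n

AgreeUpTo : ℕ → (ℕ → ℕ) → (ℕ → ℕ) → Set
AgreeUpTo n k k′ = ∀ i → 1 ≤ i → i ≤ n → k i ≡ k′ i

adjust : (ℕ → ℕ) → ℕ → (ℕ → ℕ) → ℕ → ℕ
adjust f a k i = if i ≡ᵇ a then f (k i) else k i

adjust-≡ : ∀ f a k → adjust f a k a ≡ f (k a)
adjust-≡ f a k rewrite ≡ᵇ-true {a} refl = refl

adjust-≢ : ∀ f {a} k {i} → i ≢ a → adjust f a k i ≡ k i
adjust-≢ f k i≢a rewrite ≡ᵇ-false i≢a = refl

blocks : ℕ → (ℕ → ℕ) → Word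
blocks zero k = []
blocks (suc m) k = blocks m k ++ concat (replicate (k (suc m)) (column (suc m)))

blocks-empty : ∀ m → blocks m (λ _ → 0) ≡ []
blocks-empty zero = refl
blocks-empty (suc m) = trans (++-identityʳ _) (blocks-empty m)

blocks-cong : ∀ m {k k′} → AgreeUpTo m k k′ → blocks m k ≡ blocks m k′
blocks-cong zero _ = refl
blocks-cong (suc m) k≐k′ = cong₂ _++_ (blocks-cong m (λ i 1≤i i≤m → k≐k′ i 1≤i (m≤n⇒m≤1+n i≤m)))
                                       (cong (λ r → concat (replicate r (column (suc m)))) (k≐k′ (suc m) (s≤s z≤n) ≤-refl))

power-valid : ∀ {n m} r → m ≤ n → All (Valid n) (concat (replicate r (column m)))
power-valid r m≤n = concat⁺ (replicate⁺ r (column-valid m≤n))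

blocks-valid : ∀ {n} m k → m ≤ n → All (Valid n) (blocks m k)
blocks-valid zero k _ = []
blocks-valid (suc m) k m<n = ++⁺ (blocks-valid m k (≤-trans (n≤1+n m) m<n)) (power-valid (k (suc m)) m<n)

column-comm-power : ∀ {n a b} r → a ≤ n → b ≤ n →
                    (column a ++ concat (replicate r (column b))) ≡[ n ] (concat (replicate r (column b)) ++ column a)
column-comm-power {n} {a} {b} zero _ _ = ≡⇒≡[] (++-identityʳ (column a))
column-comm-power {n} {a} {b} (suc r) a≤n b≤n = begin
  column a ++ column b ++ P                ≡⟨ ++-assoc (column a) _ _ ⟨
  (column a ++ column b) ++ P              ≈⟨ ++-congʳ (power-valid r b≤n) (column-comm a≤n b≤n) ⟩
  (column b ++ column a) ++ P              ≡⟨ ++-assoc (column b) _ _ ⟩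
  column b ++ column a ++ P                ≈⟨ ++-congˡ (column-valid b≤n) (column-comm-power r a≤n b≤n) ⟩
  column b ++ P ++ column a                ≡⟨ ++-assoc (column b) _ _ ⟨
  (column b ++ P) ++ column a              ∎
  where
  open ≡[]-Reasoning n
  P = concat (replicate r (column b))

blocks-add : ∀ {n} a m k → a ≤ m → m ≤ n → blocks m (adjust suc a k) ≡[ n ] (blocks m k ++ column a)
blocks-add a zero k z≤n _ = refl≡
blocks-add {n} a (suc m) k a≤sm sm≤n with a ≟ suc m
... | yes refl = begin
  blocks m (adjust suc a k) ++ P (adjust suc a k a)   ≡⟨ cong₂ _++_ (blocks-cong m (λ i _ i≤m → adjust-≢ suc k (<⇒≢ (s≤s i≤m))))
                                                                   (cong P (adjust-≡ suc a k)) ⟩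
  blocks m k ++ column a ++ P (k a)                    ≈⟨ ++-congˡ (blocks-valid m k m≤n) (column-comm-power (k a) sm≤n sm≤n) ⟩
  blocks m k ++ P (k a) ++ column a                    ≡⟨ ++-assoc (blocks m k) _ _ ⟨
  (blocks m k ++ P (k a)) ++ column a                  ∎
  where
  open ≡[]-Reasoning n
  P : ℕ → Word
  P r = concat (replicate r (column a))
  m≤n = ≤-trans (n≤1+n m) sm≤n
... | no a≢sm = begin
  blocks m (adjust suc a k) ++ P (adjust suc a k (suc m))   ≡⟨ cong (λ r → blocks m (adjust suc a k) ++ P r) (adjust-≢ suc k (a≢sm ∘ sym)) ⟩
  blocks m (adjust suc a k) ++ P (k (suc m))                ≈⟨ ++-congʳ (power-valid (k (suc m)) sm≤n) (blocks-add a m k a≤m m≤n) ⟩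
  (blocks m k ++ column a) ++ P (k (suc m))                 ≡⟨ ++-assoc (blocks m k) _ _ ⟩
  blocks m k ++ column a ++ P (k (suc m))                   ≈⟨ ++-congˡ (blocks-valid m k m≤n)
                                                                          (column-comm-power (k (suc m)) (≤-trans a≤sm sm≤n) sm≤n) ⟩
  blocks m k ++ P (k (suc m)) ++ column a                   ≡⟨ ++-assoc (blocks m k) _ _ ⟨
  (blocks m k ++ P (k (suc m))) ++ column a                 ∎
  where
  open ≡[]-Reasoning n
  P : ℕ → Word
  P r = concat (replicate r (column (suc m)))
  m≤n = ≤-trans (n≤1+n m) sm≤n
  a≤m = ≤-pred (≤∧≢⇒< a≤sm a≢sm)

blocks-letter : ∀ {n k k′ k₀} x → Valid n x →
                AgreeUpTo n k (adjust suc (source x) k₀) → AgreeUpTo n k′ (adjust suc (target x) k₀) →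
                (blocks n k ∷ʳ x) ≡[ n ] blocks n k′
blocks-letter {n} {k} {k′} {k₀} x vx k≐ k′≐ = begin
  blocks n k ∷ʳ x                            ≡⟨ cong (_∷ʳ x) (blocks-cong n k≐) ⟩
  blocks n (adjust suc (source x) k₀) ∷ʳ x   ≈⟨ ++-congʳ (vx ∷ []) (blocks-add (source x) n k₀ (source≤n x vx) ≤-refl) ⟩
  (blocks n k₀ ++ column (source x)) ∷ʳ x    ≡⟨ ++-assoc (blocks n k₀) _ _ ⟩
  blocks n k₀ ++ (column (source x) ∷ʳ x)    ≈⟨ ++-congˡ (blocks-valid n k₀ ≤-refl) (column-letter x vx) ⟩
  blocks n k₀ ++ column (target x)           ≈⟨ blocks-add (target x) n k₀ (target≤n x vx) ≤-refl ⟨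
  blocks n (adjust suc (target x) k₀)        ≡⟨ blocks-cong n (λ i 1≤i i≤n → sym (k′≐ i 1≤i i≤n)) ⟩
  blocks n k′                                ∎
  where open ≡[]-Reasoning n

charge-shift : ∀ {n w} x → Valid n x → NoFreeMinus n (w ∷ʳ x) →
               AgreeUpTo n (charge n w) (adjust suc (source x) (adjust pred (source x) (charge n w))) ×
               AgreeUpTo n (charge n (w ∷ʳ x)) (adjust suc (target x) (adjust pred (source x) (charge n w)))
charge-shift {n} {w} x vx nf = before , after
  where
  k = charge n w
  k₀ = adjust pred (source x) k
  before : AgreeUpTo n k (adjust suc (source x) k₀)
  before i 1≤i i≤n with i ≟ source x
  ... | yes refl = begin
    k i                 ≡⟨ suc-pred (k i) {{≢-nonZero (charge-nonzero {w = w} nf 1≤i i≤n (sign-source x vx refl))}} ⟨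
    suc (pred (k i))    ≡⟨ cong suc (adjust-≡ pred i k) ⟨
    suc (k₀ i)          ≡⟨ adjust-≡ suc i k₀ ⟨
    adjust suc i k₀ i   ∎
    where open ≡-Reasoning
  ... | no i≢s = sym (trans (adjust-≢ suc k₀ i≢s) (adjust-≢ pred k i≢s))
  after : AgreeUpTo n (charge n (w ∷ʳ x)) (adjust suc (target x) k₀)
  after i 1≤i i≤n rewrite charge-∷ʳ n i w x with i ≟ source x | i ≟ target x
  ... | yes refl | _ rewrite sign-source x vx refl =
    trans (unmatched-minus (k i)) (sym (trans (adjust-≢ suc k₀ (source≢target x vx)) (adjust-≡ pred i k)))
  ... | no i≢s | yes refl rewrite sign-target x vx refl = sym (trans (adjust-≡ suc i k₀) (cong suc (adjust-≢ pred k i≢s)))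
  ... | no i≢s | no i≢t rewrite sign-other {n} x i≢s i≢t =
    sym (trans (adjust-≢ suc k₀ i≢t) (adjust-≢ pred k i≢s))

noFreeMinus⇒≡blocks : ∀ {n w} → Reverse w → All (Valid n) w → NoFreeMinus n w → w ≡[ n ] blocks n (charge n w)
noFreeMinus⇒≡blocks {n} [] _ _ = ≡⇒≡[] (sym (blocks-empty n))
noFreeMinus⇒≡blocks {n} (w ∶ r ∶ʳ x) v nf =
  trans≡ (++-congʳ (vx ∷ []) (noFreeMinus⇒≡blocks r vw (noFreeMinus-∷ʳ⁻ {w = w} nf)))
         (blocks-letter x vx (proj₁ shift) (proj₂ shift))
  where
  vw = proj₁ (∷ʳ⁻ v)
  vx = proj₂ (∷ʳ⁻ v)
  shift = charge-shift {w = w} x vx nf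

weight-determines-charge : ∀ {n w₁ w₂} → All (Valid n) w₁ → All (Valid n) w₂ → NoFreeMinus n w₁ → NoFreeMinus n w₂ →
                           (∀ i → 1 ≤ i → i ≤ n → d w₁ i ≡ d w₂ i) → AgreeUpTo n (charge n w₁) (charge n w₂)
weight-determines-charge {n} {w₁} {w₂} v₁ v₂ nf₁ nf₂ same-d i 1≤i i≤n = +-injective (begin
  + charge n w₁ i                 ≡⟨ charge-weight (reverseView w₁) v₁ nf₁ 1≤i i≤n ⟩
  d w₁ i ℤ.- d w₁ (suc i)         ≡⟨ cong₂ ℤ._-_ (same-d i 1≤i i≤n) same-d-suc ⟩
  d w₂ i ℤ.- d w₂ (suc i)         ≡⟨ charge-weight (reverseView w₂) v₂ nf₂ 1≤i i≤n ⟨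
  + charge n w₂ i                 ∎)
  where
  open ≡-Reasoning
  same-d-suc : d w₁ (suc i) ≡ d w₂ (suc i)
  same-d-suc with m≤n⇒m<n∨m≡n i≤n
  ... | inj₁ i<n = same-d (suc i) (s≤s z≤n) i<n
  ... | inj₂ refl = trans (weight-beyond v₁) (sym (weight-beyond v₂))

corollary3p9 : ∀ (n : ℕ) (w₁ w₂ : Word) →
    All (Valid n) w₁ → All (Valid n) w₂ →
    HighestWeight n w₁ → HighestWeight n w₂ →
    (∀ i → 1 ≤ i → i ≤ n → d w₁ i ≡ d w₂ i) →
    w₁ ≡[ n ] w₂
corollary3p9 n w₁ w₂ v₁ v₂ hw₁ hw₂ same-d = begin
  w₁                        ≈⟨ noFreeMinus⇒≡blocks (reverseView w₁) v₁ nf₁ ⟩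
  blocks n (charge n w₁)    ≡⟨ blocks-cong n (weight-determines-charge v₁ v₂ nf₁ nf₂ same-d) ⟩
  blocks n (charge n w₂)    ≈⟨ noFreeMinus⇒≡blocks (reverseView w₂) v₂ nf₂ ⟨
  w₂                        ∎
  where
  open ≡[]-Reasoning n
  nf₁ : NoFreeMinus n w₁
  nf₁ = highestWeight⇒noFreeMinus {w = w₁} hw₁
  nf₂ : NoFreeMinus n w₂
  nf₂ = highestWeight⇒noFreeMinus {w = w₂} hw₂
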